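{- Let $n\ge3$ be odd, let $f,B_0,C$ be nonzero integers with $B_0$ squarefree and $\gcd(f,C)=1$, and put $B=f^2B_0$. Let $r>0$. If $[x:y:z]\in\mathcal{Y}_{B,C}(\mathbb{Z};*_2^r)$, then $2^{r-1}\mid x$, and setting $s=\min\{v_2(x),r\}$, exactly one of the following holds: (a) $s>0$, $2^s\mid y$, $2^{2s}\mid C$, and $2\nmid z$; (b) $s>0$, $2\nmid y$, $2^s\mid f$, and $2^{\lceil 2s/n\rceil}\mid z$; (c) $s=0$ and $2\nmid f$, $2\nmid y$. Moreover, in case (b), if $n\nmid s$ then $2^s\,\|\,f$.
   Context: $\mathcal{Y}_{B,C}(\mathbb{Z})$ denotes the set of primitive integer solutions $[x:y:z]$ of $x^2+By^2=Cz^n$. Let $K=\mathbb{Q}(\sqrt{ -B_0})$ with ring of integers $\mathcal{O}_K$; for an object put $u=x+f\sqrt{ -B_0}\,y$. For a prime $p$ and $r\ge0$, $p^r\|u$ means $u\in p^r\mathcal{O}_K\smallsetminus p^{r+1}\mathcal{O}_K$; condition $*_p^r$ means $p^r\|u$, and $\mathcal{Y}_{B,C}(\mathbb{Z};*_p^r)$ is the subset of objects satisfying it. $v_2(0)=\infty$. -}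

module Defs where

open import Data.Nat as ℕ using (ℕ; zero; suc)
import Data.Nat.Divisibility as ℕD
import Data.Nat.DivMod as ℕDM
open import Data.Integer using (ℤ; +_; -_; _+_; _*_; _^_; ∣_∣; _%_; 1ℤ)
open import Data.Integer.Divisibility using (_∣_)
open import Data.Integer.GCD using (gcd)
open import Data.Product using (Σ; ∃; ∃-syntax; _×_)
open import Data.Sum using (_⊎_)
open import Relation.Binary.PropositionalEquality using (_≡_; _≢_)
open import Relation.Nullary using (¬_; yes; no)

Squarefree : ℤ → Set
Squarefree b = ∀ (k : ℕ) → (k ℕ.* k) ℕD.∣ ∣ b ∣ → k ≡ 1

Primitive : ℤ → ℤ → ℤ → Set
Primitive x y z = gcd (gcd x y) z ≡ 1ℤ

IsSolution : (n : ℕ) (f B₀ C x y z : ℤ) → Set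
IsSolution n f B₀ C x y z = x * x + ((f * f) * B₀) * (y * y) ≡ C * (z ^ n)

-- InMulOK B₀ m a b  :  a + b·√(-B₀) ∈ m·𝒪_K, where K = ℚ(√(-B₀)).
-- 𝒪_K = ℤ[(1+√(-B₀))/2] if -B₀ ≡ 1 (mod 4) (i.e. B₀ ≡ 3 mod 4),
-- and 𝒪_K = ℤ[√(-B₀)] otherwise (B₀ squarefree, K quadratic).
-- In the first case a + b√(-B₀) = m(c + e(1+√(-B₀))/2)
--   ⇔ 2a = m(2c+e) and 2b = m e.
InMulOK : (B₀ m a b : ℤ) → Set
InMulOK B₀ m a b =
    (B₀ % (+ 4) ≡ 3 × ∃[ c ] ∃[ e ] ((+ 2) * a ≡ m * ((+ 2) * c + e) × (+ 2) * b ≡ m * e))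
  ⊎ (B₀ % (+ 4) ≢ 3 × ∃[ c ] ∃[ e ] (a ≡ m * c × b ≡ m * e))

ExactDivOK : (B₀ p : ℤ) (r : ℕ) (a b : ℤ) → Set
ExactDivOK B₀ p r a b = InMulOK B₀ (p ^ r) a b × ¬ InMulOK B₀ (p ^ suc r) a b

-- Condition *_p^r for the object [x:y:z]: p^r ∥ x + f√(-B₀) y.
Star : (B₀ f p : ℤ) (r : ℕ) (x y : ℤ) → Set
Star B₀ f p r x y = ExactDivOK B₀ p r x (f * y)

-- min{v₂(m), r} for m : ℕ (v₂(0) = ∞, so minV2 0 r = r).
minV2 : ℕ → ℕ → ℕ
minV2 m zero = zero
minV2 m (suc r) with 2 ℕD.∣? m
... | yes _ = suc (minV2 (m ℕDM./ 2) r)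
... | no _ = zero

-- ⌈a / n⌉ (n > 0; junk value 0 for n = 0).
ceilDiv : ℕ → ℕ → ℕ
ceilDiv a zero = zero
ceilDiv a (suc m) = (a ℕ.+ m) ℕDM./ suc m

ExactPow : (p : ℤ) (s : ℕ) (t : ℤ) → Set
ExactPow p s t = (p ^ s) ∣ t × ¬ ((p ^ suc s) ∣ t)

Odd : ℕ → Set
Odd n = ∃[ k ] n ≡ suc (2 ℕ.* k)

ExactlyOne3 : Set → Set → Set → Set
ExactlyOne3 A B C = (A × ¬ B × ¬ C) ⊎ (¬ A × B × ¬ C) ⊎ (¬ A × ¬ B × C)

sVal : ℤ → ℕ → ℕ
sVal x r = minV2 ∣ x ∣ r

-- Put u = x + f y √−B₀ and s = min(v₂(x), r). If u ∈ m𝒪_K then m ∣ 2x and m ∣ x − f y, so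
-- 2^r ∣ x − f y; hence 2^s divides both x and f y, and 2^{2s} divides the norm
-- x² + B₀ (f y)² = C zⁿ. If s = 0, x is odd and so is f y. If s > 0 and y is even, then z is odd
-- by primitivity, so f is odd (else C zⁿ would be odd), whence 2^s ∣ y and 2^{2s} ∣ C. If y is odd,
-- then 2^s ∣ f, so C is odd and 2^{2s} ∣ zⁿ. For exactness in case (b): if 2^{s+1} ∣ f, then
-- 2^{s+1} ∤ x (for s < r by the choice of s, for s = r since otherwise u ∈ 2^{r+1}𝒪_K), so
-- C zⁿ = 2^{2s}·(odd) with C odd; comparing 2-adic valuations gives n ∣ 2s, hence n ∣ s.
module Submission where

open import Defs
open import Data.Nat as ℕ using (ℕ; zero; suc; _≤_; _<_; _∸_; NonZero)
import Data.Nat.Divisibility as ℕD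
import Data.Nat.Properties as ℕP
open import Data.Nat.Primality using (Prime; prime[2])
open import Data.Empty using (⊥-elim)
open import Data.Product using (∃₂; _×_; _,_; proj₁; proj₂)
open import Data.Sum using ([_,_]′; inj₁; inj₂)
open import Function using (_∘_)
open import Relation.Nullary using (¬_; yes; no)
open import Relation.Binary.PropositionalEquality

module Nat where

  open import Data.Nat
  open import Data.Nat.Properties
  open import Data.Nat.Divisibility
  open import Data.Nat.DivMod using (_/_; m<n*o⇒m/o<n)
  open import Data.Nat.Induction using (<-rec)
  open import Data.Nat.Primality
    using (euclidsLemma; prime⇒nonZero; prime⇒nonTrivial; ¬prime[1])
  open import Data.Nat.Tactic.RingSolver using (solve-∀)
  open import Algebra.Properties.CommutativeSemigroup *-commutativeSemigroup using (x∙yz≈y∙xz)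

  ^-distribʳ-* : ∀ m n k → (m * n) ^ k ≡ m ^ k * n ^ k
  ^-distribʳ-* m n zero    = refl
  ^-distribʳ-* m n (suc k) = begin
    m * n * (m * n) ^ k      ≡⟨ cong (m * n *_) (^-distribʳ-* m n k) ⟩
    m * n * (m ^ k * n ^ k)  ≡⟨ [m*n]*[o*p]≡[m*o]*[n*p] m n (m ^ k) (n ^ k) ⟩
    m * m ^ k * (n * n ^ k)  ∎
    where open ≡-Reasoning

  [m^a*n]^k≡m^[k*a]*n^k : ∀ m a n k → (m ^ a * n) ^ k ≡ m ^ (k * a) * n ^ k
  [m^a*n]^k≡m^[k*a]*n^k m a n k = begin
    (m ^ a * n) ^ k      ≡⟨ ^-distribʳ-* (m ^ a) n k ⟩
    (m ^ a) ^ k * n ^ k  ≡⟨ cong (_* n ^ k) (^-*-assoc m a k) ⟩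
    m ^ (a * k) * n ^ k  ≡⟨ cong (λ e → m ^ e * n ^ k) (*-comm a k) ⟩
    m ^ (k * a) * n ^ k  ∎
    where open ≡-Reasoning

  ^-monoʳ-∣ : ∀ m {a b} → a ≤ b → m ^ a ∣ m ^ b
  ^-monoʳ-∣ m {a} {b} a≤b = divides (m ^ (b ∸ a)) (begin
    m ^ b                ≡⟨ cong (m ^_) (m+[n∸m]≡n a≤b) ⟨
    m ^ (a + (b ∸ a))    ≡⟨ ^-distribˡ-+-* m a (b ∸ a) ⟩
    m ^ a * m ^ (b ∸ a)  ≡⟨ *-comm (m ^ a) _ ⟩
    m ^ (b ∸ a) * m ^ a  ∎)
    where open ≡-Reasoning

  ceilDiv-≤ : ∀ n {a t} .{{_ : NonZero n}} → a ≤ n * t → ceilDiv a n ≤ t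
  ceilDiv-≤ (suc m) {a} {t} a≤n*t = ≤-pred (m<n*o⇒m/o<n (begin-strict
    a + m              ≤⟨ +-monoˡ-≤ m (≤-trans a≤n*t (≤-reflexive (*-comm (suc m) t))) ⟩
    t * suc m + m      <⟨ n<1+n _ ⟩
    suc (t * suc m + m) ≡⟨ cong suc (+-comm (t * suc m) m) ⟩
    suc t * suc m      ∎))
    where open ≤-Reasoning

  odd∣2*⇒∣ : ∀ {n s} → Odd n → n ∣ 2 * s → n ∣ s
  odd∣2*⇒∣ {s = s} (k , refl) n∣2s =
    ∣m+n∣m⇒∣n (subst (suc (2 * k) ∣_) (identity s k) (∣m⇒∣m*n (suc k) n∣2s)) (n∣m*n s)
    where
    identity : ∀ s k → 2 * s * suc k ≡ s * suc (2 * k) + s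
    identity = solve-∀

  minV2-≤ : ∀ m r → minV2 m r ≤ r
  minV2-≤ m zero = z≤n
  minV2-≤ m (suc r) with 2 ∣? m
  ... | yes _ = s≤s (minV2-≤ (m / 2) r)
  ... | no  _ = z≤n

  2^minV2∣ : ∀ m r → 2 ^ minV2 m r ∣ m
  2^minV2∣ m zero = 1∣ m
  2^minV2∣ m (suc r) with 2 ∣? m
  ... | yes 2∣m = m∣n/o⇒o*m∣n 2∣m (2^minV2∣ (m / 2) r)
  ... | no  _   = 1∣ m

  minV2<⇒2^suc∤ : ∀ m r → minV2 m r < r → 2 ^ suc (minV2 m r) ∤ m
  minV2<⇒2^suc∤ m (suc r) lt with 2 ∣? m
  ... | yes 2∣m = minV2<⇒2^suc∤ (m / 2) r (≤-pred lt) ∘ m*n∣o⇒n∣o/m 2 _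
  ... | no  2∤m = 2∤m ∘ ∣-trans (divides 1 refl)

  module _ {p : ℕ} (prime : Prime p) where

    private instance
      p≢0 : NonZero p
      p≢0 = prime⇒nonZero prime

    ∤-* : ∀ {m n} → p ∤ m → p ∤ n → p ∤ m * n
    ∤-* p∤m p∤n p∣mn = [ p∤m , p∤n ]′ (euclidsLemma _ _ prime p∣mn)

    ∤1 : p ∤ 1
    ∤1 p∣1 = ¬prime[1] (subst Prime (∣1⇒≡1 p∣1) prime)

    ∤-^ : ∀ {m} k → p ∤ m → p ∤ m ^ k
    ∤-^ zero    _   = ∤1
    ∤-^ (suc k) p∤m = ∤-* p∤m (∤-^ k p∤m)

    ∤∧^∣*⇒^∣ : ∀ k {w y} → p ∤ w → p ^ k ∣ w * y → p ^ k ∣ y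
    ∤∧^∣*⇒^∣ zero    p∤w _ = 1∣ _
    ∤∧^∣*⇒^∣ (suc k) {w} {y} p∤w p^k∣wy
      with euclidsLemma w y prime (∣-trans (m∣m*n (p ^ k)) p^k∣wy)
    ... | inj₁ p∣w = ⊥-elim (p∤w p∣w)
    ... | inj₂ (divides q refl) =
      subst (p ^ suc k ∣_) (*-comm p q)
        (*-monoʳ-∣ p (∤∧^∣*⇒^∣ k p∤w (*-cancelˡ-∣ p (subst (p ^ suc k ∣_) (swap w q p) p^k∣wy))))
      where
      swap : ∀ w q p → w * (q * p) ≡ p * (w * q)
      swap = solve-∀

    ^∣^*⇒≤ : ∀ a b {w} → p ∤ w → p ^ a ∣ p ^ b * w → a ≤ b
    ^∣^*⇒≤ zero    b       _   _ = z≤n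
    ^∣^*⇒≤ (suc a) zero    {w} p∤w h =
      ⊥-elim (p∤w (∣-trans (m∣m*n (p ^ a)) (subst (p ^ suc a ∣_) (*-identityˡ w) h)))
    ^∣^*⇒≤ (suc a) (suc b) {w} p∤w h =
      s≤s (^∣^*⇒≤ a b p∤w (*-cancelˡ-∣ p (subst (p ^ suc a ∣_) (*-assoc p (p ^ b) w) h)))

    ^*-injective : ∀ a b {u v} → p ∤ u → p ∤ v → p ^ a * u ≡ p ^ b * v → a ≡ b
    ^*-injective a b {u} {v} p∤u p∤v eq = ≤-antisym
      (^∣^*⇒≤ a b p∤v (subst (p ^ a ∣_) eq (m∣m*n u)))
      (^∣^*⇒≤ b a p∤u (subst (p ^ b ∣_) (sym eq) (m∣m*n v)))

    factor-out : ∀ m → m ≢ 0 → ∃₂ λ t w → p ∤ w × m ≡ p ^ t * w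
    factor-out = <-rec _ go
      where
      go : ∀ m → (∀ {q} → q < m → q ≢ 0 → ∃₂ λ t w → p ∤ w × q ≡ p ^ t * w) →
           m ≢ 0 → ∃₂ λ t w → p ∤ w × m ≡ p ^ t * w
      go m rec m≢0 with p ∣? m
      ... | no p∤m = 0 , m , p∤m , sym (*-identityˡ m)
      ... | yes p∣m@(divides q m≡q*p)
        with rec (quotient-< p∣m {{prime⇒nonTrivial prime}} {{≢-nonZero m≢0}}) q≢0
        where
        q≢0 : q ≢ 0
        q≢0 refl = m≢0 m≡q*p
      ... | t , w , p∤w , q≡p^t*w = suc t , w , p∤w , (begin
        m              ≡⟨ m≡q*p ⟩
        q * p          ≡⟨ cong (_* p) q≡p^t*w ⟩
        p ^ t * w * p  ≡⟨ rotate (p ^ t) w p ⟩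
        p * p ^ t * w  ∎)
        where
        open ≡-Reasoning
        rotate : ∀ a w p → a * w * p ≡ p * a * w
        rotate = solve-∀

    ^∣^⇒^⌈/⌉∣ : ∀ n {a} z .{{_ : NonZero n}} → p ^ a ∣ z ^ n → p ^ ceilDiv a n ∣ z
    ^∣^⇒^⌈/⌉∣ n zero        _ = _ ∣0
    ^∣^⇒^⌈/⌉∣ n {a} z@(suc _) p^a∣z^n with factor-out z (λ ())
    ... | t , w , p∤w , z≡p^t*w =
      ∣-trans (^-monoʳ-∣ p (ceilDiv-≤ n a≤n*t)) (subst (p ^ t ∣_) (sym z≡p^t*w) (m∣m*n w))
      where
      z^n≡p^[n*t]*w^n : z ^ n ≡ p ^ (n * t) * w ^ n
      z^n≡p^[n*t]*w^n = trans (cong (_^ n) z≡p^t*w) ([m^a*n]^k≡m^[k*a]*n^k p t w n)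
      a≤n*t : a ≤ n * t
      a≤n*t = ^∣^*⇒≤ a (n * t) (∤-^ n p∤w) (subst (p ^ a ∣_) z^n≡p^[n*t]*w^n p^a∣z^n)

    ^*≡*^⇒∣ : ∀ n {a u c} z .{{_ : NonZero n}} → p ∤ u → p ∤ c → p ^ a * u ≡ c * z ^ n → n ∣ a
    ^*≡*^⇒∣ (suc _) {a} {u} {c} zero p∤u _ eq
      with m*n≡0⇒m≡0∨n≡0 (p ^ a) (trans eq (*-zeroʳ c))
    ... | inj₁ p^a≡0 = ⊥-elim (≢-nonZero⁻¹ p (m^n≡0⇒m≡0 p a p^a≡0))
    ... | inj₂ u≡0   = ⊥-elim (p∤u (subst (p ∣_) (sym u≡0) (p ∣0)))
    ^*≡*^⇒∣ n {a} {u} {c} z@(suc _) p∤u p∤c eq with factor-out z (λ ())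
    ... | t , w , p∤w , z≡p^t*w =
      divides t (trans (^*-injective a (n * t) p∤u (∤-* p∤c (∤-^ n p∤w)) (begin
        p ^ a * u                    ≡⟨ eq ⟩
        c * z ^ n                    ≡⟨ cong (λ v → c * v ^ n) z≡p^t*w ⟩
        c * (p ^ t * w) ^ n          ≡⟨ cong (c *_) ([m^a*n]^k≡m^[k*a]*n^k p t w n) ⟩
        c * (p ^ (n * t) * w ^ n)    ≡⟨ x∙yz≈y∙xz c (p ^ (n * t)) (w ^ n) ⟩
        p ^ (n * t) * (c * w ^ n)    ∎)) (*-comm n t))
      where open ≡-Reasoning

-- Signed divisibility is used throughout, since its record type lets Agda infer the divided
-- terms; the statement's unsigned ∣ (divisibility of absolute values) is written ∣ᵤ.
module Int where

  open import Data.Integer using (ℤ; +_; _+_; _-_; _*_; _^_; _%_; ∣_∣; 1ℤ)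
  import Data.Integer.Properties as ℤP
  open ℤP using (abs-*; ^-distribˡ-+-*; *-cancelˡ-≡)
  open import Data.Integer.Divisibility using () renaming (_∣_ to _∣ᵤ_)
  open import Data.Integer.Divisibility.Signed
  open import Data.Integer.GCD using (gcd; gcd-greatest)
  open import Data.Integer.Tactic.RingSolver using (solve-∀)

  ∣i^n∣≡∣i∣^n : ∀ i n → ∣ i ^ n ∣ ≡ ∣ i ∣ ℕ.^ n
  ∣i^n∣≡∣i∣^n i zero    = refl
  ∣i^n∣≡∣i∣^n i (suc n) = trans (abs-* i (i ^ n)) (cong (∣ i ∣ ℕ.*_) (∣i^n∣≡∣i∣^n i n))

  +^∣⇒^∣∣∣ : ∀ m k {i} → (+ m) ^ k ∣ i → m ℕ.^ k ℕD.∣ ∣ i ∣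
  +^∣⇒^∣∣∣ m k = subst (ℕD._∣ _) (∣i^n∣≡∣i∣^n (+ m) k) ∘ ∣⇒∣ᵤ

  ^∣∣∣⇒+^∣ : ∀ m k {i} → m ℕ.^ k ℕD.∣ ∣ i ∣ → (+ m) ^ k ∣ i
  ^∣∣∣⇒+^∣ m k = ∣ᵤ⇒∣ ∘ subst (ℕD._∣ _) (sym (∣i^n∣≡∣i∣^n (+ m) k))

  ^-monoʳ-∣ : ∀ i {a b} → a ≤ b → i ^ a ∣ i ^ b
  ^-monoʳ-∣ i {a} {b} a≤b = divides (i ^ (b ∸ a)) (begin
    i ^ b                ≡⟨ cong (i ^_) (ℕP.m+[n∸m]≡n a≤b) ⟨
    i ^ (a ℕ.+ (b ∸ a))  ≡⟨ ^-distribˡ-+-* i a (b ∸ a) ⟩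
    i ^ a * i ^ (b ∸ a)  ≡⟨ ℤP.*-comm (i ^ a) _ ⟩
    i ^ (b ∸ a) * i ^ a  ∎)
    where open ≡-Reasoning

  ^∣⇒∣ : ∀ i {k j} → 0 < k → i ^ k ∣ j → i ∣ j
  ^∣⇒∣ i {suc k} _ = ∣-trans (∣m⇒∣m*n (i ^ k) ∣-refl)

  i^n*i^n≡i^[2*n] : ∀ i n → i ^ n * i ^ n ≡ i ^ (2 ℕ.* n)
  i^n*i^n≡i^[2*n] i n = begin
    i ^ n * i ^ n  ≡⟨ ^-distribˡ-+-* i n n ⟨
    i ^ (n ℕ.+ n)  ≡⟨ cong (λ k → i ^ (n ℕ.+ k)) (ℕP.+-identityʳ n) ⟨
    i ^ (2 ℕ.* n)  ∎
    where open ≡-Reasoning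

  ∣m-n∣m⇒∣n : ∀ {k i j} → k ∣ i - j → k ∣ i → k ∣ j
  ∣m-n∣m⇒∣n {i = i} {j} k∣i-j k∣i = subst (_ ∣_) (i-[i-j]≡j i j) (∣m∣n⇒∣m-n k∣i k∣i-j)
    where
    i-[i-j]≡j : ∀ i j → i - (i - j) ≡ j
    i-[i-j]≡j = solve-∀

  ∣m-n∣n⇒∣m : ∀ {k i j} → k ∣ i - j → k ∣ j → k ∣ i
  ∣m-n∣n⇒∣m {i = i} {j} k∣i-j k∣j = subst (_ ∣_) ([i-j]+j≡i i j) (∣m∣n⇒∣m+n k∣i-j k∣j)
    where
    [i-j]+j≡i : ∀ i j → (i - j) + j ≡ i
    [i-j]+j≡i = solve-∀

  ∣m∣n⇒*∣m*m+c*[n*n] : ∀ {k i j} c → k ∣ i → k ∣ j → k * k ∣ i * i + c * (j * j)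
  ∣m∣n⇒*∣m*m+c*[n*n] {k} c (divides a refl) (divides b refl) =
    divides (a * a + c * (b * b)) (factor a b c k)
    where
    factor : ∀ a b c k → a * k * (a * k) + c * (b * k * (b * k)) ≡ (a * a + c * (b * b)) * (k * k)
    factor = solve-∀

  module _ {p : ℕ} (prime : Prime p) where

    ∤-* : ∀ {i j} → ¬ + p ∣ i → ¬ + p ∣ j → ¬ + p ∣ i * j
    ∤-* {i} {j} p∤i p∤j =
      Nat.∤-* prime (p∤i ∘ ∣ᵤ⇒∣) (p∤j ∘ ∣ᵤ⇒∣) ∘ subst (p ℕD.∣_) (abs-* i j) ∘ ∣⇒∣ᵤ

    ∤-^ : ∀ {i} n → ¬ + p ∣ i → ¬ + p ∣ i ^ n
    ∤-^ {i} n p∤i = Nat.∤-^ prime n (p∤i ∘ ∣ᵤ⇒∣) ∘ subst (p ℕD.∣_) (∣i^n∣≡∣i∣^n i n) ∘ ∣⇒∣ᵤ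

    ∤∧^∣*⇒^∣ : ∀ k {w j} → ¬ + p ∣ w → (+ p) ^ k ∣ w * j → (+ p) ^ k ∣ j
    ∤∧^∣*⇒^∣ k {w} {j} p∤w = ^∣∣∣⇒+^∣ p k ∘ Nat.∤∧^∣*⇒^∣ prime k (p∤w ∘ ∣ᵤ⇒∣)
      ∘ subst (p ℕ.^ k ℕD.∣_) (abs-* w j) ∘ +^∣⇒^∣∣∣ p k

    ^∣^⇒^⌈/⌉∣ : ∀ n {a} z .{{_ : NonZero n}} → (+ p) ^ a ∣ z ^ n → (+ p) ^ ceilDiv a n ∣ z
    ^∣^⇒^⌈/⌉∣ n {a} z = ^∣∣∣⇒+^∣ p (ceilDiv a n) ∘ Nat.^∣^⇒^⌈/⌉∣ prime n ∣ z ∣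
      ∘ subst (p ℕ.^ a ℕD.∣_) (∣i^n∣≡∣i∣^n z n) ∘ +^∣⇒^∣∣∣ p a

    ^*≡*^⇒∣ : ∀ n {a u c} z .{{_ : NonZero n}} →
              ¬ + p ∣ u → ¬ + p ∣ c → (+ p) ^ a * u ≡ c * z ^ n → n ℕD.∣ a
    ^*≡*^⇒∣ n {a} {u} {c} z p∤u p∤c eq =
      Nat.^*≡*^⇒∣ prime n ∣ z ∣ (p∤u ∘ ∣ᵤ⇒∣) (p∤c ∘ ∣ᵤ⇒∣) (begin
        p ℕ.^ a ℕ.* ∣ u ∣        ≡⟨ cong (ℕ._* ∣ u ∣) (∣i^n∣≡∣i∣^n (+ p) a) ⟨
        ∣ (+ p) ^ a ∣ ℕ.* ∣ u ∣  ≡⟨ abs-* ((+ p) ^ a) u ⟨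
        ∣ (+ p) ^ a * u ∣        ≡⟨ cong ∣_∣ eq ⟩
        ∣ c * z ^ n ∣            ≡⟨ abs-* c (z ^ n) ⟩
        ∣ c ∣ ℕ.* ∣ z ^ n ∣      ≡⟨ cong (∣ c ∣ ℕ.*_) (∣i^n∣≡∣i∣^n z n) ⟩
        ∣ c ∣ ℕ.* ∣ z ∣ ℕ.^ n    ∎)
      where open ≡-Reasoning

    gcd≡1∧∣⇒∤ : ∀ {i j} → gcd i j ≡ 1ℤ → + p ∣ i → ¬ + p ∣ j
    gcd≡1∧∣⇒∤ {i} {j} gcd≡1 p∣i p∣j =
      Nat.∤1 prime (subst (+ p ∣ᵤ_) gcd≡1 (gcd-greatest {i} {j} {+ p} (∣⇒∣ᵤ p∣i) (∣⇒∣ᵤ p∣j)))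

    primitive∧∣∧∣⇒∤ : ∀ {i j k} → Primitive i j k → + p ∣ i → + p ∣ j → ¬ + p ∣ k
    primitive∧∣∧∣⇒∤ {i} {j} {k} prim p∣i p∣j =
      gcd≡1∧∣⇒∤ {gcd i j} {k} prim (∣ᵤ⇒∣ (gcd-greatest {i} {j} {+ p} (∣⇒∣ᵤ p∣i) (∣⇒∣ᵤ p∣j)))

  ∤-m*m+4*n : ∀ {i} j → ¬ + 2 ∣ i → ¬ + 2 ∣ i * i + + 4 * j
  ∤-m*m+4*n {i} j 2∤i 2∣sum =
    ∤-* prime[2] 2∤i 2∤i (∣m+n∣n⇒∣m 2∣sum (divides (+ 2 * j) (4*j≡2*j*2 j)))
    where
    4*j≡2*j*2 : ∀ j → + 4 * j ≡ + 2 * j * + 2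
    4*j≡2*j*2 = solve-∀

  InMulOK⇒∣2* : ∀ {B₀ m i j} → InMulOK B₀ m i j → m ∣ + 2 * i
  InMulOK⇒∣2* {m = m} (inj₁ (_ , c , e , 2i≡m[2c+e] , _)) =
    divides (+ 2 * c + e) (trans 2i≡m[2c+e] (ℤP.*-comm m _))
  InMulOK⇒∣2* {m = m} (inj₂ (_ , c , e , i≡mc , _)) =
    ∣n⇒∣m*n (+ 2) (divides c (trans i≡mc (ℤP.*-comm m c)))

  -- When 𝒪_K = ℤ[(1 + √−B₀)/2], the generator contributes equally to both coordinates.
  InMulOK⇒∣- : ∀ {B₀ m i j} → InMulOK B₀ m i j → m ∣ i - j
  InMulOK⇒∣- {m = m} {i} {j} (inj₁ (_ , c , e , 2i≡m[2c+e] , 2j≡me)) =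
    divides c (*-cancelˡ-≡ (+ 2) (i - j) (c * m) (begin
      + 2 * (i - j)              ≡⟨ distribute i j ⟩
      + 2 * i - + 2 * j          ≡⟨ cong₂ _-_ 2i≡m[2c+e] 2j≡me ⟩
      m * (+ 2 * c + e) - m * e  ≡⟨ rearrange m c e ⟩
      + 2 * (c * m)              ∎))
    where
    open ≡-Reasoning
    distribute : ∀ i j → + 2 * (i - j) ≡ + 2 * i - + 2 * j
    distribute = solve-∀
    rearrange : ∀ m c e → m * (+ 2 * c + e) - m * e ≡ + 2 * (c * m)
    rearrange = solve-∀
  InMulOK⇒∣- {m = m} {i} {j} (inj₂ (_ , c , e , i≡mc , j≡me)) =
    divides (c - e) (begin
      i - j          ≡⟨ cong₂ _-_ i≡mc j≡me ⟩
      m * c - m * e  ≡⟨ rearrange m c e ⟩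
      (c - e) * m    ∎)
    where
    open ≡-Reasoning
    rearrange : ∀ m c e → m * c - m * e ≡ (c - e) * m
    rearrange = solve-∀

  ∣∧∣⇒InMulOK : ∀ B₀ {m i j} → m ∣ i → m ∣ j → InMulOK B₀ m i j
  ∣∧∣⇒InMulOK B₀ {m} (divides a refl) (divides b refl) with B₀ % + 4 ℕP.≟ 3
  ... | yes B₀≡3 = inj₁ (B₀≡3 , a - b , + 2 * b , witness₁ a b m , witness₂ b m)
    where
    witness₁ : ∀ a b m → + 2 * (a * m) ≡ m * (+ 2 * (a - b) + + 2 * b)
    witness₁ = solve-∀
    witness₂ : ∀ b m → + 2 * (b * m) ≡ m * (+ 2 * b)
    witness₂ = solve-∀
  ... | no B₀≢3 = inj₂ (B₀≢3 , a , b , ℤP.*-comm a m , ℤP.*-comm b m)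

  InMulOK-2^r⇒2^[r-1]∣ : ∀ {B₀ i j} r → InMulOK B₀ ((+ 2) ^ r) i j → (+ 2) ^ (r ∸ 1) ∣ i
  InMulOK-2^r⇒2^[r-1]∣ {i = i} zero _ = divides i (sym (ℤP.*-identityʳ i))
  InMulOK-2^r⇒2^[r-1]∣ {B₀} (suc r) inside = *-cancelˡ-∣ (+ 2) (InMulOK⇒∣2* {B₀} inside)

  Case-a : (s : ℕ) (y C z : ℤ) → Set
  Case-a s y C z = 0 < s × ((+ 2) ^ s ∣ᵤ y) × ((+ 2) ^ (2 ℕ.* s) ∣ᵤ C) × ¬ ((+ 2) ∣ᵤ z)

  Case-b : (n s : ℕ) (y f z : ℤ) → Set
  Case-b n s y f z = 0 < s × ¬ ((+ 2) ∣ᵤ y) × ((+ 2) ^ s ∣ᵤ f) × ((+ 2) ^ ceilDiv (2 ℕ.* s) n ∣ᵤ z)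

  Case-c : (s : ℕ) (f y : ℤ) → Set
  Case-c s f y = s ≡ 0 × ¬ ((+ 2) ∣ᵤ f) × ¬ ((+ 2) ∣ᵤ y)

  module Classification
    {n : ℕ} (odd : Odd n) {f B₀ C x y z : ℤ}
    (coprime : gcd f C ≡ 1ℤ) (prim : Primitive x y z) (solution : IsSolution n f B₀ C x y z)
    {r : ℕ} (0<r : 0 < r) (inside : InMulOK B₀ ((+ 2) ^ r) x (f * y))
    (outside : ¬ InMulOK B₀ ((+ 2) ^ suc r) x (f * y))
    {s : ℕ} (2^s∣x : (+ 2) ^ s ∣ x) (s≤r : s ≤ r) (2^1+s∤x : s < r → ¬ (+ 2) ^ suc s ∣ x)
    where

    private instance
      n≢0 : NonZero n
      n≢0 = subst NonZero (sym (proj₂ odd)) _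

    norm≡Cz^n : x * x + B₀ * (f * y * (f * y)) ≡ C * z ^ n
    norm≡Cz^n = trans (rearrange x f y B₀) solution
      where
      rearrange : ∀ x f y B₀ → x * x + B₀ * (f * y * (f * y)) ≡ x * x + f * f * B₀ * (y * y)
      rearrange = solve-∀

    2^r∣x-fy : (+ 2) ^ r ∣ x - f * y
    2^r∣x-fy = InMulOK⇒∣- {B₀} inside

    2^s∣fy : (+ 2) ^ s ∣ f * y
    2^s∣fy = ∣m-n∣m⇒∣n (∣-trans (^-monoʳ-∣ (+ 2) s≤r) 2^r∣x-fy) 2^s∣x

    2∣f⇒2∤C : + 2 ∣ f → ¬ + 2 ∣ C
    2∣f⇒2∤C = gcd≡1∧∣⇒∤ prime[2] {f} {C} coprime

    2^2s∣Cz^n : (+ 2) ^ (2 ℕ.* s) ∣ C * z ^ n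
    2^2s∣Cz^n = subst₂ _∣_ (i^n*i^n≡i^[2*n] (+ 2) s) norm≡Cz^n (∣m∣n⇒*∣m*m+c*[n*n] B₀ 2^s∣x 2^s∣fy)

    case-c : s ≡ 0 → Case-c s f y
    case-c refl = refl , 2∤f ∘ ∣ᵤ⇒∣ , 2∤y ∘ ∣ᵤ⇒∣
      where
      2∤fy : ¬ + 2 ∣ f * y
      2∤fy = 2^1+s∤x 0<r ∘ ∣m-n∣n⇒∣m (^∣⇒∣ (+ 2) 0<r 2^r∣x-fy)
      2∤f : ¬ + 2 ∣ f
      2∤f = 2∤fy ∘ ∣m⇒∣m*n y
      2∤y : ¬ + 2 ∣ y
      2∤y = 2∤fy ∘ ∣n⇒∣m*n f

    case-a : 0 < s → + 2 ∣ y → Case-a s y C z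
    case-a 0<s 2∣y = 0<s , ∣⇒∣ᵤ 2^s∣y , ∣⇒∣ᵤ 2^2s∣C , 2∤z ∘ ∣ᵤ⇒∣
      where
      2∤z : ¬ + 2 ∣ z
      2∤z = primitive∧∣∧∣⇒∤ prime[2] prim (^∣⇒∣ (+ 2) 0<s 2^s∣x) 2∣y
      2∤z^n : ¬ + 2 ∣ z ^ n
      2∤z^n = ∤-^ prime[2] n 2∤z
      2∤f : ¬ + 2 ∣ f
      2∤f 2∣f = ∤-* prime[2] (2∣f⇒2∤C 2∣f) 2∤z^n
        (^∣⇒∣ (+ 2) (ℕP.<-≤-trans 0<s (ℕP.m≤m+n s _)) 2^2s∣Cz^n)
      2^s∣y : (+ 2) ^ s ∣ y
      2^s∣y = ∤∧^∣*⇒^∣ prime[2] s 2∤f 2^s∣fy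
      2^2s∣C : (+ 2) ^ (2 ℕ.* s) ∣ C
      2^2s∣C = ∤∧^∣*⇒^∣ prime[2] (2 ℕ.* s) 2∤z^n (subst (_ ∣_) (ℤP.*-comm C (z ^ n)) 2^2s∣Cz^n)

    case-b : 0 < s → ¬ + 2 ∣ y → Case-b n s y f z
    case-b 0<s 2∤y = 0<s , 2∤y ∘ ∣ᵤ⇒∣ , ∣⇒∣ᵤ 2^s∣f , ∣⇒∣ᵤ (^∣^⇒^⌈/⌉∣ prime[2] n z 2^2s∣z^n)
      where
      2^s∣f : (+ 2) ^ s ∣ f
      2^s∣f = ∤∧^∣*⇒^∣ prime[2] s 2∤y (subst (_ ∣_) (ℤP.*-comm f y) 2^s∣fy)
      2^2s∣z^n : (+ 2) ^ (2 ℕ.* s) ∣ z ^ n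
      2^2s∣z^n = ∤∧^∣*⇒^∣ prime[2] (2 ℕ.* s) (2∣f⇒2∤C (^∣⇒∣ (+ 2) 0<s 2^s∣f)) 2^2s∣Cz^n

    2^1+s∣fy⇒2^1+s∤x : (+ 2) ^ suc s ∣ f * y → ¬ (+ 2) ^ suc s ∣ x
    2^1+s∣fy⇒2^1+s∤x 2^1+s∣fy with ℕP.m≤n⇒m<n∨m≡n s≤r
    ... | inj₁ s<r  = 2^1+s∤x s<r
    ... | inj₂ refl = λ 2^1+s∣x → outside (∣∧∣⇒InMulOK B₀ 2^1+s∣x 2^1+s∣fy)

    2^1+s∤f : ¬ n ℕD.∣ s → ¬ (+ 2) ^ suc s ∣ f
    2^1+s∤f n∤s 2^1+s∣f = n∤s (Nat.odd∣2*⇒∣ odd (n∣2s 2^s∣x (∣m⇒∣m*n y 2^1+s∣f)))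
      where
      P : ℤ
      P = (+ 2) ^ s
      expand : ∀ P a b B₀ → P * P * (a * a + + 4 * (B₀ * (b * b)))
                          ≡ a * P * (a * P) + B₀ * (b * (+ 2 * P) * (b * (+ 2 * P)))
      expand = solve-∀
      n∣2s : P ∣ x → (+ 2) ^ suc s ∣ f * y → n ℕD.∣ 2 ℕ.* s
      n∣2s (divides a x≡a*P) 2^1+s∣fy@(divides b fy≡b*2P) =
        ^*≡*^⇒∣ prime[2] n z (∤-m*m+4*n (B₀ * (b * b)) 2∤a) 2∤C (begin
          (+ 2) ^ (2 ℕ.* s) * (a * a + + 4 * (B₀ * (b * b)))
            ≡⟨ cong (_* _) (i^n*i^n≡i^[2*n] (+ 2) s) ⟨
          P * P * (a * a + + 4 * (B₀ * (b * b)))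
            ≡⟨ expand P a b B₀ ⟩
          a * P * (a * P) + B₀ * (b * (+ 2 * P) * (b * (+ 2 * P)))
            ≡⟨ cong₂ (λ u v → u * u + B₀ * (v * v)) x≡a*P fy≡b*2P ⟨
          x * x + B₀ * (f * y * (f * y))
            ≡⟨ norm≡Cz^n ⟩
          C * z ^ n
            ∎)
        where
        open ≡-Reasoning
        2∤a : ¬ + 2 ∣ a
        2∤a 2∣a = 2^1+s∣fy⇒2^1+s∤x 2^1+s∣fy (subst (_ ∣_) (sym x≡a*P) (*-monoˡ-∣ P 2∣a))
        2∤C : ¬ + 2 ∣ C
        2∤C = 2∣f⇒2∤C (^∣⇒∣ (+ 2) {suc s} ℕ.z<s 2^1+s∣f)

    2^[r-1]∣x : (+ 2) ^ (r ∸ 1) ∣ᵤ x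
    2^[r-1]∣x = ∣⇒∣ᵤ (InMulOK-2^r⇒2^[r-1]∣ {B₀} r inside)

    classification : ExactlyOne3 (Case-a s y C z) (Case-b n s y f z) (Case-c s f y)
    classification with s ℕP.≟ 0 | + 2 ∣? y
    ... | yes s≡0 | _       = inj₂ (inj₂ (s≯0 ∘ proj₁ , s≯0 ∘ proj₁ , case-c s≡0))
      where
      s≯0 : ¬ 0 < s
      s≯0 0<s = ℕP.<⇒≢ 0<s (sym s≡0)
    ... | no s≢0  | yes 2∣y =
      inj₁ (case-a (ℕP.n≢0⇒n>0 s≢0) 2∣y , (λ b → proj₁ (proj₂ b) (∣⇒∣ᵤ 2∣y)) , s≢0 ∘ proj₁)
    ... | no s≢0  | no 2∤y  =
      inj₂ (inj₁ (2∤y ∘ ^∣⇒∣ (+ 2) 0<s ∘ ∣ᵤ⇒∣ ∘ proj₁ ∘ proj₂ , case-b 0<s 2∤y , s≢0 ∘ proj₁))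
      where
      0<s : 0 < s
      0<s = ℕP.n≢0⇒n>0 s≢0

    exactness : Case-b n s y f z → ¬ n ℕD.∣ s → ExactPow (+ 2) s f
    exactness (_ , _ , 2^s∣f , _) n∤s = 2^s∣f , 2^1+s∤f n∤s ∘ ∣ᵤ⇒∣

open import Data.Integer as ℤ using (ℤ; +_; -_; _*_; _^_; 0ℤ; 1ℤ)
open import Data.Integer.Divisibility using (_∣_)
open import Data.Integer.GCD using (gcd)
open Int using (module Classification; ^∣∣∣⇒+^∣; +^∣⇒^∣∣∣)

lemma4p13 : (n : ℕ) → 3 ≤ n → Odd n →
    (f B₀ C : ℤ) → f ≢ 0ℤ → B₀ ≢ 0ℤ → C ≢ 0ℤ → Squarefree B₀ → B₀ ≢ - 1ℤ →
    gcd f C ≡ 1ℤ →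
    (r : ℕ) → 0 < r →
    (x y z : ℤ) → Primitive x y z → IsSolution n f B₀ C x y z →
    Star B₀ f (+ 2) r x y →
    ((+ 2) ^ (r ∸ 1) ∣ x)
    × ExactlyOne3
        (0 < (sVal x r) × (+ 2) ^ (sVal x r) ∣ y
          × (+ 2) ^ (2 ℕ.* (sVal x r)) ∣ C × ¬ ((+ 2) ∣ z))
        (0 < (sVal x r) × ¬ ((+ 2) ∣ y) × (+ 2) ^ (sVal x r) ∣ f
          × (+ 2) ^ ceilDiv (2 ℕ.* (sVal x r)) n ∣ z)
        ((sVal x r) ≡ 0 × ¬ ((+ 2) ∣ f) × ¬ ((+ 2) ∣ y))
    × ((0 < (sVal x r) × ¬ ((+ 2) ∣ y) × (+ 2) ^ (sVal x r) ∣ f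
          × (+ 2) ^ ceilDiv (2 ℕ.* (sVal x r)) n ∣ z)
        → ¬ (n ℕD.∣ (sVal x r)) → ExactPow (+ 2) ((sVal x r)) f)
lemma4p13 n _ odd f B₀ C _ _ _ _ _ coprime r 0<r x y z prim solution (inside , outside) =
  2^[r-1]∣x , classification , exactness
  where
  s : ℕ
  s = sVal x r
  open Classification odd {f} {B₀} {C} {x} {y} {z} coprime prim solution 0<r inside outside
    (^∣∣∣⇒+^∣ 2 s (Nat.2^minV2∣ ℤ.∣ x ∣ r)) (Nat.minV2-≤ ℤ.∣ x ∣ r)
    (λ s<r → Nat.minV2<⇒2^suc∤ ℤ.∣ x ∣ r s<r ∘ +^∣⇒^∣∣∣ 2 (suc s))
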